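{- Let $n \geq 0$ and let $d$ be an integer. For every set of leaves $B \subseteq 2^n$ with $\mathrm{LTD}(B) \leq d$, \[ |B| \leq \binom{n}{0} + \binom{n}{1} + \cdots + \binom{n}{d}. \]
   Context: For $n \geq 0$, $2^{\leq n}$ denotes the set of binary sequences of length at most $n$, and $2^n$ the set of binary sequences of length exactly $n$; the elements of $2^n$ are called leaves. For nodes $a,b$, write $a \prec b$ if $a$ is a proper initial segment of $b$. The meet $b \wedge b'$ is the longest common initial segment of $b$ and $b'$. Write $b \sim b'$ if $|b| = |b'|$. For a leaf $b$, its branch $\check b$ is the set of all initial segments of $b$, including $b$ itself. For $B \subseteq 2^n$, let $\check B = \bigcup_{b\in B}\check b$, the set of all initial segments of elements of $B$. The leveled binary tree of height $d$ is the structure $\widetilde T_d = (2^{\leq d}, \prec, \wedge, \sim)$. For substructures, an embedding $f$ from $(A,\prec,\wedge,\sim)$ into $(A',\prec,\wedge,\sim)$ is an injective map satisfying, for all $a,a' \in A$: - $a \prec a'$ iff $f(a) \prec f(a')$; - $f(a \wedge a') = f(a) \wedge f(a')$; - $a \sim a'$ iff $f(a) \sim f(a')$. For nonempty $B \subseteq 2^n$, the leveled tree dimension $\mathrm{LTD}(B)$ is the largest nonnegative integer $d$ such that $\widetilde T_d$ embeds in $(\check B, \prec, \wedge, \sim)$. If $B = \emptyset$, set $\mathrm{LTD}(B) = -1$. Binomial coefficients $\binom{n}{i}$ with $i > n$ are $0$. -}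

module Defs where

open import Data.Bool using (Bool; true; false; if_then_else_; _∧_)
open import Data.Bool.Properties using () renaming (_≟_ to _≟ᵇ_)
open import Data.Nat using (ℕ; zero; suc; _≤_)
open import Data.Nat.Combinatorics using (_C_)
open import Data.Integer using (ℤ; +_; -[1+_])
open import Data.List using (List; []; _∷_; _++_; length; map; upTo)
open import Data.Nat.ListAction using (sum)
open import Data.List.Membership.Propositional using (_∈_)
open import Data.Vec using (Vec; toList)
open import Data.Product using (Σ; _×_; ∃)
open import Data.Sum using (_⊎_)
open import Function.Bundles using (_⇔_)
open import Relation.Binary.PropositionalEquality using (_≡_; _≢_)
open import Relation.Nullary using (does)

Node : Set
Node = List Bool

_≺_ : Node → Node → Set
a ≺ b = Σ Node (λ c → c ≢ [] × a ++ c ≡ b)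

_≼_ : Node → Node → Set
a ≼ b = Σ Node (λ c → a ++ c ≡ b)

meet : Node → Node → Node
meet (x ∷ xs) (y ∷ ys) = if does (x ≟ᵇ y) then x ∷ meet xs ys else []
meet _ _ = []

_∼_ : Node → Node → Set
a ∼ b = length a ≡ length b

_∈ˇ_ : ∀ {n} → Node → List (Vec Bool n) → Set
a ∈ˇ B = ∃ λ b → b ∈ B × a ≼ toList b

InT : ℕ → Node → Set
InT d a = length a ≤ d

-- The leveled binary tree T̃_d embeds in (B̌, ≺, ∧, ∼).
-- f is defined on all nodes, but only its values on 2^{≤d} matter.
Embeds : ∀ {n} → ℕ → List (Vec Bool n) → Set
Embeds d B =
  Σ (Node → Node) λ f →
    (∀ a → InT d a → f a ∈ˇ B) ×
    (∀ a a' → InT d a → InT d a' →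
        (f a ≡ f a' → a ≡ a') ×
        ((a ≺ a') ⇔ (f a ≺ f a')) ×
        (f (meet a a') ≡ meet (f a) (f a')) ×
        ((a ∼ a') ⇔ (f a ∼ f a')))

IsLTD : ∀ {n} → List (Vec Bool n) → ℤ → Set
IsLTD B k =
  (B ≡ [] × k ≡ -[1+ 0 ]) ⊎
  (B ≢ [] × Σ ℕ λ d → k ≡ + d × Embeds d B × (∀ m → Embeds m B → m ≤ d))

binomSum : ℕ → ℤ → ℕ
binomSum n (+ d) = sum (map (n C_) (upTo (suc d)))
binomSum n -[1+ _ ] = 0

module Submission where

-- Induction on n, splitting every leaf on its last bit. For a set P of nodes of length n + 1
-- let P∨ (resp. P∧) be the nodes of length n with some (resp. both) one-bit extensions in P, so
-- that |P| = |P∨| + |P∧|. Extending the leaves of a leveled tree in P∨ by one bit gives a tree in P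
-- with as many levels, and splitting each leaf of a tree in P∧ into its two children gives a tree
-- in P with one more level. Hence LTD(P∨) ≤ LTD(P) and LTD(P∧) < LTD(P), and Pascal's rule for
-- the partial sums C(n,0) + … + C(n,d) closes the induction. Such a tree embeds T̃_d because it
-- preserves meets and sends levels to levels.

open import Defs
open import Data.Bool using (Bool; true; false; _∨_; _∧_; if_then_else_)
open import Data.Bool.Properties using () renaming (_≟_ to _≟ᵇ_)
open import Data.Empty using (⊥-elim)
open import Data.Integer using (ℤ; +≤+) renaming (_≤_ to _≤ℤ_; +_ to ℤ+_)
open import Data.List using (List; []; _∷_; _++_; _∷ʳ_; [_]; length; map; reverse; upTo)
open import Data.List.Membership.Propositional using (_∈_)
open import Data.List.Membership.Propositional.Properties using (∈-map⁺; ∈-map⁻; ∈-++⁺ˡ; ∈-++⁺ʳ)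
open import Data.List.Properties
  using (++-assoc; ++-identityʳ; ++-identityʳ-unique; length-++; length-map; length-reverse;
         reverse-involutive; unfold-reverse; upTo-∷ʳ; map-++; ≡-dec)
open import Data.List.Relation.Unary.All as All using (All; _∷_)
open import Data.List.Relation.Unary.All.Properties using (map⁺)
open import Data.List.Relation.Unary.AllPairs using (_∷_)
open import Data.List.Relation.Unary.Any using (here; there)
open import Data.List.Relation.Unary.Unique.Propositional using (Unique)
import Data.List.Relation.Unary.Unique.Propositional.Properties as Unique
open import Data.Nat using (ℕ; zero; suc; _+_; _≤_; _<_; z≤n; s≤s)
open import Data.Nat.Combinatorics using (_C_; nCk+nC[k+1]≡[n+1]C[k+1])
open import Data.Nat.ListAction using (sum)
open import Data.Nat.ListAction.Properties using (sum-++)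
open import Data.Nat.Properties
open import Algebra.Properties.CommutativeSemigroup +-commutativeSemigroup using (interchange)
open import Data.Product using (_×_; _,_; proj₁; proj₂; ∃)
open import Data.Sum using (_⊎_; inj₁; inj₂; [_,_]′)
open import Data.Vec using (Vec; toList)
open import Data.Vec.Properties using (toList-injective; length-toList; cast-is-id)
open import Function using (_∘_)
open import Function.Bundles using (_⇔_; mk⇔; Equivalence)
open import Relation.Binary.Definitions using (DecidableEquality)
open import Relation.Binary.PropositionalEquality hiding ([_])
open import Relation.Nullary using (does; yes; no)
open import Relation.Nullary.Decidable using (dec-true; dec-false; _⊎-dec_; _×-dec_)
open import Relation.Unary using (Pred; Decidable)
open import Level using (0ℓ)

count : {A : Set} → (A → Bool) → List A → ℕ
count p [] = 0
count p (x ∷ xs) = if p x then suc (count p xs) else count p xs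

module _ {A : Set} where

  count-++ : ∀ (p : A → Bool) xs ys → count p (xs ++ ys) ≡ count p xs + count p ys
  count-++ p [] ys = refl
  count-++ p (x ∷ xs) ys with p x
  ... | true = cong suc (count-++ p xs ys)
  ... | false = count-++ p xs ys

  count-map : ∀ {B : Set} (p : B → Bool) (f : A → B) xs → count p (map f xs) ≡ count (p ∘ f) xs
  count-map p f [] = refl
  count-map p f (x ∷ xs) with p (f x)
  ... | true = cong suc (count-map p f xs)
  ... | false = count-map p f xs

  count-∨-∧ : ∀ (p q : A → Bool) xs →
              count p xs + count q xs ≡ count (λ x → p x ∨ q x) xs + count (λ x → p x ∧ q x) xs
  count-∨-∧ p q [] = refl
  count-∨-∧ p q (x ∷ xs) with p x | q x
  ... | true | true =
    cong suc (trans (+-suc _ _) (trans (cong suc (count-∨-∧ p q xs)) (sym (+-suc _ _))))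
  ... | true | false = cong suc (count-∨-∧ p q xs)
  ... | false | true = trans (+-suc _ _) (cong suc (count-∨-∧ p q xs))
  ... | false | false = count-∨-∧ p q xs

  count≤length : ∀ (p : A → Bool) xs → count p xs ≤ length xs
  count≤length p [] = z≤n
  count≤length p (x ∷ xs) with p x
  ... | true = s≤s (count≤length p xs)
  ... | false = m≤n⇒m≤1+n (count≤length p xs)

  count-none : ∀ {p : A → Bool} → (∀ x → p x ≡ false) → ∀ xs → count p xs ≡ 0
  count-none none [] = refl
  count-none none (x ∷ xs) rewrite none x = count-none none xs

  ∈⇒0<count : ∀ {p : A → Bool} {x xs} → x ∈ xs → p x ≡ true → 0 < count p xs
  ∈⇒0<count (here refl) px rewrite px = s≤s z≤n
  ∈⇒0<count {p} {xs = y ∷ xs} (there x∈) px with p y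
  ... | true = s≤s z≤n
  ... | false = ∈⇒0<count x∈ px

module _ {A : Set} (_≟_ : DecidableEquality A) where
  open import Data.List.Membership.DecPropositional _≟_ using (_∈?_)

  length≤count-∈? : ∀ {xs ys} → Unique xs → All (_∈ ys) xs → length xs ≤ count (λ x → does (x ∈? xs)) ys
  length≤count-∈? {[]} _ _ = z≤n
  length≤count-∈? {y ∷ xs} {ys} (y∉xs ∷ unique) (y∈ys ∷ xs⊆ys) = begin
    suc (length xs)
      ≤⟨ +-mono-≤ (∈⇒0<count y∈ys (dec-true (y ≟ y) refl)) (length≤count-∈? unique xs⊆ys) ⟩
    count isY ys + count (λ x → does (x ∈? xs)) ys
      ≡⟨ count-∨-∧ isY (λ x → does (x ∈? xs)) ys ⟩
    count (λ x → does (x ∈? (y ∷ xs))) ys + count (λ x → isY x ∧ does (x ∈? xs)) ys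
      ≡⟨ cong (count (λ x → does (x ∈? (y ∷ xs))) ys +_) (count-none notBoth ys) ⟩
    count (λ x → does (x ∈? (y ∷ xs))) ys + 0
      ≡⟨ +-identityʳ _ ⟩
    count (λ x → does (x ∈? (y ∷ xs))) ys ∎
    where
    open ≤-Reasoning
    isY : A → Bool
    isY x = does (x ≟ y)
    notBoth : ∀ x → (isY x ∧ does (x ∈? xs)) ≡ false
    notBoth x with x ≟ y
    ... | yes refl = dec-false (y ∈? xs) (λ y∈xs → All.lookup y∉xs y∈xs refl)
    ... | no _ = refl

binomPrefix : ℕ → ℕ → ℕ
binomPrefix n zero = 0
binomPrefix n (suc d) = binomPrefix n d + n C d

binomPrefix-pascal : ∀ n d → binomPrefix (suc n) (suc d) ≡ binomPrefix n (suc d) + binomPrefix n d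
binomPrefix-pascal n zero = refl
binomPrefix-pascal n (suc d) = begin
  binomPrefix (suc n) (suc d) + suc n C suc d
    ≡⟨ cong₂ _+_ (binomPrefix-pascal n d) (sym (nCk+nC[k+1]≡[n+1]C[k+1] n d)) ⟩
  (binomPrefix n (suc d) + binomPrefix n d) + (n C d + n C suc d)
    ≡⟨ cong ((binomPrefix n (suc d) + binomPrefix n d) +_) (+-comm (n C d) (n C suc d)) ⟩
  (binomPrefix n (suc d) + binomPrefix n d) + (n C suc d + n C d)
    ≡⟨ interchange (binomPrefix n (suc d)) (binomPrefix n d) (n C suc d) (n C d) ⟩
  binomPrefix n (suc (suc d)) + binomPrefix n (suc d) ∎
  where open ≡-Reasoning

1≤binomPrefix-suc : ∀ n d → 1 ≤ binomPrefix n (suc d)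
1≤binomPrefix-suc n zero = ≤-refl
1≤binomPrefix-suc n (suc d) = ≤-trans (1≤binomPrefix-suc n d) (m≤m+n _ _)

sum-C-upTo≡binomPrefix : ∀ n d → sum (map (n C_) (upTo d)) ≡ binomPrefix n d
sum-C-upTo≡binomPrefix n zero = refl
sum-C-upTo≡binomPrefix n (suc d) = begin
  sum (map (n C_) (upTo (suc d)))          ≡⟨ cong (sum ∘ map (n C_)) (sym (upTo-∷ʳ d)) ⟩
  sum (map (n C_) (upTo d ∷ʳ d))           ≡⟨ cong sum (map-++ (n C_) (upTo d) [ d ]) ⟩
  sum (map (n C_) (upTo d) ++ [ n C d ])   ≡⟨ sum-++ (map (n C_) (upTo d)) [ n C d ] ⟩
  sum (map (n C_) (upTo d)) + (n C d + 0)  ≡⟨ cong₂ _+_ (sum-C-upTo≡binomPrefix n d) (+-identityʳ _) ⟩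
  binomPrefix n d + n C d                  ∎
  where open ≡-Reasoning

toList-injective-≡ : ∀ {A : Set} {n} {u v : Vec A n} → toList u ≡ toList v → u ≡ v
toList-injective-≡ {u = u} {v} eq = trans (sym (cast-is-id refl u)) (toList-injective refl u v eq)

≼-refl : ∀ {a} → a ≼ a
≼-refl {a} = [] , ++-identityʳ a

≼-reflexive : ∀ {a b} → a ≡ b → a ≼ b
≼-reflexive refl = ≼-refl

≼-trans : ∀ {a b c} → a ≼ b → b ≼ c → a ≼ c
≼-trans {a} (u , refl) (v , refl) = u ++ v , sym (++-assoc a u v)

≼-length : ∀ {a b} → a ≼ b → length a ≤ length b
≼-length {a} (c , refl) = ≤-trans (m≤m+n (length a) (length c)) (≤-reflexive (sym (length-++ a)))

≼∧length≡⇒≡ : ∀ {a b} → a ≼ b → length a ≡ length b → a ≡ b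
≼∧length≡⇒≡ {a} ([] , refl) _ = sym (++-identityʳ a)
≼∧length≡⇒≡ {a} (x ∷ c , refl) eq = ⊥-elim (m+1+n≢m (length a) (sym (trans eq (length-++ a))))

≼-antisym : ∀ {a b} → a ≼ b → b ≼ a → a ≡ b
≼-antisym a≼b b≼a = ≼∧length≡⇒≡ a≼b (≤-antisym (≼-length a≼b) (≼-length b≼a))

≺⇔≼×≢ : ∀ {a b} → a ≺ b ⇔ (a ≼ b × a ≢ b)
≺⇔≼×≢ {a} = mk⇔
  (λ (c , c≢[] , e) → (c , e) , λ a≡b → c≢[] (++-identityʳ-unique a (trans a≡b (sym e))))
  (λ ((c , e) , a≢b) → c , (λ { refl → a≢b (trans (sym (++-identityʳ a)) e) }) , e)

meet-∷ : ∀ x u v → meet (x ∷ u) (x ∷ v) ≡ x ∷ meet u v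
meet-∷ false u v = refl
meet-∷ true u v = refl

meet-∷-≢ : ∀ {x y} u v → x ≢ y → meet (x ∷ u) (y ∷ v) ≡ []
meet-∷-≢ {x} {y} u v x≢y rewrite dec-false (x ≟ᵇ y) x≢y = refl

meet-comm : ∀ a b → meet a b ≡ meet b a
meet-comm [] [] = refl
meet-comm [] (y ∷ b) = refl
meet-comm (x ∷ a) [] = refl
meet-comm (false ∷ a) (false ∷ b) = cong (false ∷_) (meet-comm a b)
meet-comm (false ∷ a) (true ∷ b) = refl
meet-comm (true ∷ a) (false ∷ b) = refl
meet-comm (true ∷ a) (true ∷ b) = cong (true ∷_) (meet-comm a b)

meet-++ : ∀ r u v → meet (r ++ u) (r ++ v) ≡ r ++ meet u v
meet-++ [] u v = refl
meet-++ (x ∷ r) u v = trans (meet-∷ x (r ++ u) (r ++ v)) (cong (x ∷_) (meet-++ r u v))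

meet-≼ˡ : ∀ a b → meet a b ≼ a
meet-≼ˡ [] b = ≼-refl
meet-≼ˡ (x ∷ a) [] = x ∷ a , refl
meet-≼ˡ (x ∷ a) (y ∷ b) with x ≟ᵇ y
... | yes refl = let (c , e) = meet-≼ˡ a b in c , cong (x ∷_) e
... | no _ = x ∷ a , refl

meet-≼ʳ : ∀ a b → meet a b ≼ b
meet-≼ʳ a b = subst (_≼ b) (meet-comm b a) (meet-≼ˡ b a)

≼⇒meet≡ˡ : ∀ {a b} → a ≼ b → meet a b ≡ a
≼⇒meet≡ˡ {[]} _ = refl
≼⇒meet≡ˡ {x ∷ a} (c , refl) = trans (meet-∷ x a (a ++ c)) (cong (x ∷_) (≼⇒meet≡ˡ (c , refl)))

≼⇒meet≡ʳ : ∀ {a b} → b ≼ a → meet a b ≡ b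
≼⇒meet≡ʳ {a} {b} b≼a = trans (meet-comm a b) (≼⇒meet≡ˡ b≼a)

meet-diverge : ∀ {r x y b b' u v} → b ≢ b' → (r ++ b ∷ u) ≼ x → (r ++ b' ∷ v) ≼ y → meet x y ≡ r
meet-diverge {r} {b = b} {b'} {u} {v} b≢b' (c , refl) (c' , refl) = begin
  meet ((r ++ b ∷ u) ++ c) ((r ++ b' ∷ v) ++ c')
    ≡⟨ cong₂ meet (++-assoc r (b ∷ u) c) (++-assoc r (b' ∷ v) c') ⟩
  meet (r ++ b ∷ u ++ c) (r ++ b' ∷ v ++ c')
    ≡⟨ meet-++ r (b ∷ u ++ c) (b' ∷ v ++ c') ⟩
  r ++ meet (b ∷ u ++ c) (b' ∷ v ++ c')
    ≡⟨ cong (r ++_) (meet-∷-≢ (u ++ c) (v ++ c') b≢b') ⟩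
  r ++ []
    ≡⟨ ++-identityʳ r ⟩
  r ∎
  where open ≡-Reasoning

module _ {d : ℕ} (f : Node → Node) (h : ℕ → ℕ)
         (f-meet : ∀ a a' → f (meet a a') ≡ meet (f a) (f a'))
         (length-f : ∀ a → length (f a) ≡ h (length a))
         (h-injective : ∀ {i j} → i ≤ d → j ≤ d → h i ≡ h j → i ≡ j) where

  -- Prefixes are recovered from meets (a ≼ a' iff meet a a' ≡ a), and a node from its prefix of
  -- the same length, which h determines.
  private
    meet-fixed : ∀ {a a'} → InT d a → f (meet a a') ≡ f a → meet a a' ≡ a
    meet-fixed {a} {a'} a∈T eq = ≼∧length≡⇒≡ (meet-≼ˡ a a')
      (h-injective (≤-trans (≼-length (meet-≼ˡ a a')) a∈T) a∈T
        (trans (sym (length-f (meet a a'))) (trans (cong length eq) (length-f a))))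

    ≼-preserve : ∀ {a a'} → a ≼ a' → f a ≼ f a'
    ≼-preserve {a} {a'} a≼a' =
      subst (_≼ f a') (trans (sym (f-meet a a')) (cong f (≼⇒meet≡ˡ a≼a'))) (meet-≼ʳ (f a) (f a'))

    ≼-reflect : ∀ {a a'} → InT d a → f a ≼ f a' → a ≼ a'
    ≼-reflect {a} {a'} a∈T fa≼fa' =
      subst (_≼ a') (meet-fixed a∈T (trans (f-meet a a') (≼⇒meet≡ˡ fa≼fa'))) (meet-≼ʳ a a')

    injective : ∀ {a a'} → InT d a → InT d a' → f a ≡ f a' → a ≡ a'
    injective a∈T a'∈T eq =
      ≼-antisym (≼-reflect a∈T (≼-reflexive eq)) (≼-reflect a'∈T (≼-reflexive (sym eq)))

  meet-level-preserving⇒Embeds : ∀ {n} {B : List (Vec Bool n)} → (∀ a → InT d a → f a ∈ˇ B) → Embeds d B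
  meet-level-preserving⇒Embeds f∈B = f , f∈B , λ a a' a∈T a'∈T →
    injective a∈T a'∈T ,
    mk⇔ (λ a≺a' → let (a≼a' , a≢a') = Equivalence.to ≺⇔≼×≢ a≺a' in
                   Equivalence.from ≺⇔≼×≢ (≼-preserve a≼a' , a≢a' ∘ injective a∈T a'∈T))
        (λ fa≺fa' → let (fa≼fa' , fa≢fa') = Equivalence.to ≺⇔≼×≢ fa≺fa' in
                     Equivalence.from ≺⇔≼×≢ (≼-reflect a∈T fa≼fa' , fa≢fa' ∘ cong f)) ,
    f-meet a a' ,
    mk⇔ (λ a∼a' → trans (length-f a) (trans (cong h a∼a') (sym (length-f a'))))
        (λ fa∼fa' → h-injective a∈T a'∈T (trans (sym (length-f a)) (trans fa∼fa' (length-f a'))))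

-- A copy of T̃_(length ks) rooted at r with leaves in P: below a node of level i, the child on
-- side b is reached by the bit b followed by the segment gap b of length ks[i].
data LeveledTree (P : Pred Node 0ℓ) : Node → List ℕ → Set where
  leaf : ∀ {r} → P r → LeveledTree P r []
  fork : ∀ {r k ks} (gap : Bool → Node) → (∀ b → length (gap b) ≡ k) →
         (∀ b → LeveledTree P (r ++ b ∷ gap b) ks) → LeveledTree P r (k ∷ ks)

LTD< : ℕ → Pred Node 0ℓ → Set
LTD< d P = ∀ {r ks} → LeveledTree P r ks → length ks < d

levelDepth : List ℕ → ℕ → ℕ
levelDepth [] _ = 0
levelDepth (k ∷ ks) zero = 0
levelDepth (k ∷ ks) (suc j) = suc k + levelDepth ks j

levelDepth-injective : ∀ ks {i j} → i ≤ length ks → j ≤ length ks →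
                       levelDepth ks i ≡ levelDepth ks j → i ≡ j
levelDepth-injective [] z≤n z≤n _ = refl
levelDepth-injective (k ∷ ks) {zero} {zero} _ _ _ = refl
levelDepth-injective (k ∷ ks) {zero} {suc j} _ _ ()
levelDepth-injective (k ∷ ks) {suc i} {zero} _ _ ()
levelDepth-injective (k ∷ ks) {suc i} {suc j} (s≤s i≤) (s≤s j≤) eq =
  cong suc (levelDepth-injective ks i≤ j≤ (+-cancelˡ-≡ (suc k) _ _ eq))

module _ {P : Pred Node 0ℓ} where

  -- The image of an address of T̃_(length ks); longer addresses stop at a leaf.
  node : ∀ {r ks} → LeveledTree P r ks → Node → Node
  node {r} (leaf _) _ = r
  node {r} (fork _ _ _) [] = r
  node (fork _ _ t) (b ∷ a) = node (t b) a

  root-≼-node : ∀ {r ks} (t : LeveledTree P r ks) a → r ≼ node t a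
  root-≼-node (leaf _) a = ≼-refl
  root-≼-node (fork _ _ _) [] = ≼-refl
  root-≼-node (fork gap _ t) (b ∷ a) = ≼-trans (b ∷ gap b , refl) (root-≼-node (t b) a)

  length-node : ∀ {r ks} (t : LeveledTree P r ks) a →
                length (node t a) ≡ length r + levelDepth ks (length a)
  length-node {r} (leaf _) a = sym (+-identityʳ (length r))
  length-node {r} (fork _ _ _) [] = sym (+-identityʳ (length r))
  length-node {r} (fork {k = k} {ks} gap gap-length t) (b ∷ a) = begin
    length (node (t b) a)                               ≡⟨ length-node (t b) a ⟩
    length (r ++ b ∷ gap b) + levelDepth ks (length a)  ≡⟨ cong (_+ levelDepth ks (length a)) length-child ⟩
    length r + suc k + levelDepth ks (length a)         ≡⟨ +-assoc (length r) (suc k) _ ⟩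
    length r + (suc k + levelDepth ks (length a))       ∎
    where
    open ≡-Reasoning
    length-child : length (r ++ b ∷ gap b) ≡ length r + suc k
    length-child = trans (length-++ r) (cong (λ m → length r + suc m) (gap-length b))

  node-meet : ∀ {r ks} (t : LeveledTree P r ks) a a' → node t (meet a a') ≡ meet (node t a) (node t a')
  node-meet (leaf _) a a' = sym (≼⇒meet≡ˡ ≼-refl)
  node-meet t@(fork _ _ _) [] a' = sym (≼⇒meet≡ˡ (root-≼-node t a'))
  node-meet t@(fork _ _ _) (x ∷ a) [] = sym (≼⇒meet≡ʳ (root-≼-node t (x ∷ a)))
  node-meet (fork _ _ t) (b ∷ a) (b' ∷ a') with b ≟ᵇ b'
  ... | yes refl = node-meet (t b) a a'
  ... | no b≢b' = sym (meet-diverge b≢b' (root-≼-node (t b) a) (root-≼-node (t b') a'))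

  leaf-below-node : ∀ {r ks} (t : LeveledTree P r ks) a → ∃ λ l → P l × node t a ≼ l
  leaf-below-node (leaf p) a = _ , p , ≼-refl
  leaf-below-node (fork gap _ t) [] =
    let (l , p , below) = leaf-below-node (t false) []
    in l , p , ≼-trans (≼-trans (false ∷ gap false , refl) (root-≼-node (t false) [])) below
  leaf-below-node (fork _ _ t) (b ∷ a) = leaf-below-node (t b) a

LeveledTree⇒Embeds : ∀ {n} {B : List (Vec Bool n)} {r ks} →
                     LeveledTree (_∈ map toList B) r ks → Embeds (length ks) B
LeveledTree⇒Embeds {B = B} {r} {ks} t =
  meet-level-preserving⇒Embeds (node t) (λ j → length r + levelDepth ks j) (node-meet t) (length-node t)
    (λ i≤ j≤ eq → levelDepth-injective ks i≤ j≤ (+-cancelˡ-≡ (length r) _ _ eq))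
    (λ a _ → let (l , l∈ , below) = leaf-below-node t a
                 (v , v∈B , l≡v) = ∈-map⁻ toList l∈
             in v , v∈B , subst (node t a ≼_) l≡v below)

SomeChild BothChildren : Pred Node 0ℓ → Pred Node 0ℓ
SomeChild P x = P (x ∷ʳ false) ⊎ P (x ∷ʳ true)
BothChildren P x = P (x ∷ʳ false) × P (x ∷ʳ true)

incrementLast : ℕ → List ℕ → List ℕ
incrementLast k [] = [ suc k ]
incrementLast k (k' ∷ ks) = k ∷ incrementLast k' ks

length-incrementLast : ∀ k ks → length (incrementLast k ks) ≡ suc (length ks)
length-incrementLast k [] = refl
length-incrementLast k (k' ∷ ks) = cong suc (length-incrementLast k' ks)

leafLabel : ∀ {P r} → LeveledTree P r [] → P r
leafLabel (leaf p) = p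

module _ {P : Pred Node 0ℓ} where

  -- Every leaf grows by one bit, so only the last gap grows.
  extendLeaves : ∀ {r k ks} → LeveledTree (SomeChild P) r (k ∷ ks) → LeveledTree P r (incrementLast k ks)
  extendLeaves {r} {k} {[]} (fork gap gap-length t) =
    fork extendedGap extendedGap-length (λ b → leaf (subst P (++-assoc r (b ∷ gap b) _) (proj₂ (child b))))
    where
    child : ∀ b → ∃ λ c → P ((r ++ b ∷ gap b) ∷ʳ c)
    child b = [ (false ,_) , (true ,_) ]′ (leafLabel (t b))
    extendedGap : Bool → Node
    extendedGap b = gap b ∷ʳ proj₁ (child b)
    extendedGap-length : ∀ b → length (extendedGap b) ≡ suc k
    extendedGap-length b = trans (length-++ (gap b)) (trans (+-comm _ 1) (cong suc (gap-length b)))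
  extendLeaves {ks = _ ∷ _} (fork gap gap-length t) = fork gap gap-length (extendLeaves ∘ t)

  LTD<-someChild : ∀ {d} → LTD< d P → LTD< d (SomeChild P)
  LTD<-someChild noTree (leaf (inj₁ p)) = noTree (leaf p)
  LTD<-someChild noTree (leaf (inj₂ p)) = noTree (leaf p)
  LTD<-someChild noTree t@(fork {k = k} {ks} _ _ _) =
    subst (_< _) (length-incrementLast k ks) (noTree (extendLeaves t))

  splitLeaves : ∀ {r ks} → LeveledTree (BothChildren P) r ks → LeveledTree P r (ks ∷ʳ 0)
  splitLeaves (leaf (p₀ , p₁)) = fork (λ _ → []) (λ _ → refl) λ { false → leaf p₀ ; true → leaf p₁ }
  splitLeaves (fork gap gap-length t) = fork gap gap-length (splitLeaves ∘ t)

  LTD<-bothChildren : ∀ {d} → LTD< (suc d) P → LTD< d (BothChildren P)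
  LTD<-bothChildren noTree {ks = ks} t =
    ≤-pred (subst (_< _) (trans (length-++ ks) (+-comm _ 1)) (noTree (splitLeaves t)))

nodesOfLength : ℕ → List Node
nodesOfLength zero = [ [] ]
nodesOfLength (suc n) = map (_∷ʳ false) (nodesOfLength n) ++ map (_∷ʳ true) (nodesOfLength n)

∷ʳ-∈-nodesOfLength : ∀ {x n} b → x ∈ nodesOfLength n → x ∷ʳ b ∈ nodesOfLength (suc n)
∷ʳ-∈-nodesOfLength false x∈ = ∈-++⁺ˡ (∈-map⁺ (_∷ʳ false) x∈)
∷ʳ-∈-nodesOfLength {n = n} true x∈ = ∈-++⁺ʳ (map (_∷ʳ false) (nodesOfLength n)) (∈-map⁺ (_∷ʳ true) x∈)

∈-nodesOfLength : ∀ x → x ∈ nodesOfLength (length x)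
∈-nodesOfLength x =
  subst₂ (λ y m → y ∈ nodesOfLength m) (reverse-involutive x) (length-reverse x) (reverse-∈ (reverse x))
  where
  reverse-∈ : ∀ x → reverse x ∈ nodesOfLength (length x)
  reverse-∈ [] = here refl
  reverse-∈ (b ∷ x) = subst (_∈ nodesOfLength (suc (length x))) (sym (unfold-reverse b x))
                             (∷ʳ-∈-nodesOfLength {n = length x} b (reverse-∈ x))

toList-∈-nodesOfLength : ∀ {n} (v : Vec Bool n) → toList v ∈ nodesOfLength n
toList-∈-nodesOfLength v =
  subst (λ m → toList v ∈ nodesOfLength m) (length-toList v) (∈-nodesOfLength (toList v))

count-nodesOfLength-suc : ∀ p n → count p (nodesOfLength (suc n)) ≡
  count (λ x → p (x ∷ʳ false)) (nodesOfLength n) + count (λ x → p (x ∷ʳ true)) (nodesOfLength n)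
count-nodesOfLength-suc p n =
  trans (count-++ p (map (_∷ʳ false) L) (map (_∷ʳ true) L))
        (cong₂ _+_ (count-map p (_∷ʳ false) L) (count-map p (_∷ʳ true) L))
  where
  L : List Node
  L = nodesOfLength n

count≤binomPrefix : ∀ n d {P : Pred Node 0ℓ} (P? : Decidable P) → LTD< d P →
                    count (does ∘ P?) (nodesOfLength n) ≤ binomPrefix n d
count≤binomPrefix n zero P? noTree =
  ≤-reflexive (count-none (λ x → dec-false (P? x) (λ p → n≮0 (noTree (leaf p)))) (nodesOfLength n))
count≤binomPrefix zero (suc d) P? _ = ≤-trans (count≤length (does ∘ P?) [ [] ]) (1≤binomPrefix-suc 0 d)
count≤binomPrefix (suc n) (suc d) {P} P? noTree = begin
  count (does ∘ P?) (nodesOfLength (suc n))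
    ≡⟨ count-nodesOfLength-suc (does ∘ P?) n ⟩
  count (does ∘ P? ∘ (_∷ʳ false)) L + count (does ∘ P? ∘ (_∷ʳ true)) L
    ≡⟨ count-∨-∧ (does ∘ P? ∘ (_∷ʳ false)) (does ∘ P? ∘ (_∷ʳ true)) L ⟩
  count (does ∘ someChild?) L + count (does ∘ bothChildren?) L
    ≤⟨ +-mono-≤ (count≤binomPrefix n (suc d) someChild? (LTD<-someChild noTree))
                (count≤binomPrefix n d bothChildren? (LTD<-bothChildren noTree)) ⟩
  binomPrefix n (suc d) + binomPrefix n d
    ≡⟨ sym (binomPrefix-pascal n d) ⟩
  binomPrefix (suc n) (suc d) ∎
  where
  open ≤-Reasoning
  L : List Node
  L = nodesOfLength n
  someChild? : Decidable (SomeChild P)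
  someChild? x = P? (x ∷ʳ false) ⊎-dec P? (x ∷ʳ true)
  bothChildren? : Decidable (BothChildren P)
  bothChildren? x = P? (x ∷ʳ false) ×-dec P? (x ∷ʳ true)

theorem1p3 : (n : ℕ) (d : ℤ) (B : List (Vec Bool n)) → Unique B →
    (k : ℤ) → IsLTD B k → k ≤ℤ d → length B ≤ binomSum n d
theorem1p3 n d B _ k (inj₁ (refl , _)) _ = z≤n
theorem1p3 n (ℤ+ d) B unique _ (inj₂ (_ , k , refl , _ , maximal)) (+≤+ k≤d) = begin
  length B
    ≡⟨ sym (length-map toList B) ⟩
  length leaves
    ≤⟨ length≤count-∈? (≡-dec _≟ᵇ_) (Unique.map⁺ toList-injective-≡ unique)
                                       (map⁺ (All.universal toList-∈-nodesOfLength B)) ⟩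
  count (λ x → does (x ∈? leaves)) (nodesOfLength n)
    ≤⟨ count≤binomPrefix n (suc d) (_∈? leaves) noTree ⟩
  binomPrefix n (suc d)
    ≡⟨ sym (sum-C-upTo≡binomPrefix n (suc d)) ⟩
  binomSum n (ℤ+ d) ∎
  where
  open ≤-Reasoning
  open import Data.List.Membership.DecPropositional (≡-dec _≟ᵇ_) using (_∈?_)
  leaves : List Node
  leaves = map toList B
  noTree : LTD< (suc d) (_∈ leaves)
  noTree t = s≤s (≤-trans (maximal _ (LeveledTree⇒Embeds t)) k≤d)
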